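{- Let $n \geq 1$ and $k \geq 3$ be integers. If the hypercube $Q_n$ has a $C_k$-decomposition, then $Q_{3n}$ has an $L_{2k}$-decomposition.
   Context: For a positive integer $d$, the hypercube $Q_d$ is the graph whose vertices are the binary strings of length $d$, two vertices being adjacent if and only if they differ in exactly one position. $C_k$ denotes the cycle of length $k$. The sunlet graph $L_{2k}$ is the graph obtained from $C_k$ by attaching one pendant edge (to a new vertex) at each vertex of the cycle. For a graph $H$, an $H$-decomposition of a graph $G$ is a collection of edge-disjoint subgraphs of $G$, each isomorphic to $H$, whose edge sets partition $E(G)$. -}

module Defs where

open import Data.Nat using (ℕ; zero; suc; _+_)
open import Data.Nat.DivMod using (_mod_)
open import Data.Bool using (Bool; true; false)
open import Data.Vec using (Vec; []; _∷_)
open import Data.Fin using (Fin; toℕ; _↑ˡ_; _↑ʳ_; splitAt)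
open import Data.Product using (Σ; _×_; _,_; proj₁; proj₂)
open import Data.Sum using (_⊎_; inj₁; inj₂)
open import Relation.Binary.PropositionalEquality using (_≡_)
open import Function.Definitions using (Injective)

hamming : ∀ {d} → Vec Bool d → Vec Bool d → ℕ
hamming [] [] = 0
hamming (true  ∷ u) (true  ∷ v) = hamming u v
hamming (false ∷ u) (false ∷ v) = hamming u v
hamming (true  ∷ u) (false ∷ v) = suc (hamming u v)
hamming (false ∷ u) (true  ∷ v) = suc (hamming u v)

QVertex : ℕ → Set
QVertex d = Vec Bool d

QAdj : ∀ {d} → QVertex d → QVertex d → Set
QAdj u v = hamming u v ≡ 1

-- A finite (pattern) graph given by its vertex set Fin nV and an
-- enumeration of its edges (each edge listed once, as an ordered pair).
record FinGraph : Set where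
  field
    nV    : ℕ
    nE    : ℕ
    edge  : Fin nE → Fin nV × Fin nV
open FinGraph public

cycNext : ∀ {k} → Fin k → Fin k
cycNext {suc n} i = suc (toℕ i) mod (suc n)

Cycle : ℕ → FinGraph
Cycle k = record { nV = k ; nE = k ; edge = λ i → (i , cycNext i) }

-- The sunlet L_{2k}: cycle vertices i ↑ˡ k (i < k), pendant vertices
-- raise k i; edges: cycle edges and the pendant edges {cycle i, pendant i}.
sunletEdge : (k : ℕ) → Fin (k + k) → Fin (k + k) × Fin (k + k)
sunletEdge k e with splitAt k e
... | inj₁ i = ((i ↑ˡ k) , (cycNext i ↑ˡ k))
... | inj₂ i = ((i ↑ˡ k) , k ↑ʳ i)

Sunlet : ℕ → FinGraph
Sunlet k = record { nV = k + k ; nE = k + k ; edge = sunletEdge k }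

-- A subgraph of Q_d isomorphic to H: an injective map of V(H) into V(Q_d)
-- sending edges to edges; the subgraph's edges are the images of H's edges.
record QCopy (H : FinGraph) (d : ℕ) : Set where
  field
    φ     : Fin (nV H) → QVertex d
    inj   : Injective _≡_ _≡_ φ
    hom   : ∀ e → QAdj (φ (proj₁ (edge H e))) (φ (proj₂ (edge H e)))
open QCopy public

Covers : ∀ {H d} → QCopy H d → Fin (nE H) → QVertex d → QVertex d → Set
Covers {H} c e u v =
  (φ c (proj₁ (edge H e)) ≡ u × φ c (proj₂ (edge H e)) ≡ v)
  ⊎ (φ c (proj₁ (edge H e)) ≡ v × φ c (proj₂ (edge H e)) ≡ u)

-- An H-decomposition of Q_d: a finite family of copies of H in Q_d such that
-- every edge of Q_d is the image of exactly one (copy, edge of H) pair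
-- (so the copies are edge-disjoint and their edge sets partition E(Q_d)).
HDecomposition : FinGraph → ℕ → Set
HDecomposition H d =
  Σ ℕ λ N → Σ (Fin N → QCopy H d) λ copies →
    ∀ (u v : QVertex d) → QAdj u v →
      Σ (Fin N × Fin (nE H)) (λ p → Covers (copies (proj₁ p)) (proj₂ p) u v)
      × (∀ j e j′ e′ → Covers (copies j) e u v → Covers (copies j′) e′ u v
           → (j ≡ j′) × (e ≡ e′))

-- Write a vertex of Q_{3n} as a triple (x, y, z) of vertices of Q_n. Then
-- (x, y, z) ↦ x ⊕ y ⊕ z maps each edge of Q_{3n} onto an edge of Q_n in the same
-- direction, so an edge of Q_{3n} is the same thing as a lift of an oriented edge
-- c_i c_{i+1} of one of the given cycles: a start vertex t over c_i and the block
-- in which the edge moves. Every cycle c lifts to sunlets of two kinds: for all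
-- y, z the x-copy with rim (c_i ⊕ y ⊕ z, y, z), and for all x and all EVEN z the
-- y-copy with rim (x, c_i ⊕ x ⊕ z, z). Spokes of a y-copy move z along the
-- incoming cycle direction. Spokes of an x-copy move z along the outgoing direction
-- if z is even, and otherwise move y, along the outgoing or incoming direction
-- according to the parity of x. Sorting the lifts by block and by these parities
-- shows that each lift is a rim edge or a spoke of exactly one copy.

module Submission where

open import Defs
open import Data.Nat using (ℕ; zero; suc; pred; _+_; _*_; _≤_; s≤s)
open import Data.Bool using (Bool; true; false; not; _xor_)
open import Data.Bool.Properties
  using (xor-assoc; xor-comm; xor-same; xor-identityʳ; not-involutive; not-distribˡ-xor; not-distribʳ-xor)
open import Data.Vec using (Vec; []; _∷_; _++_; zipWith; replicate; tail)
import Data.Vec as Vec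
open import Data.Vec.Properties using (zipWith-assoc; zipWith-comm; zipWith-identityʳ; ∷-injectiveʳ; ++-injective)
open import Data.Fin using (Fin; zero; suc; toℕ; fromℕ; inject₁; splitAt; join)
open import Data.Fin.Properties
  using (toℕ-injective; toℕ-fromℕ<; toℕ-inject₁; toℕ<n; toℕ-fromℕ; 2↔Bool; +↔⊎; *↔×;
         splitAt-↑ˡ; splitAt-↑ʳ; splitAt-join; join-splitAt)
open import Data.Fin.Relation.Unary.Top using (view; ‵fromℕ; ‵inj₁)
open import Data.Nat.DivMod using (_%_; m<n⇒m%n≡m; n%n≡0)
open import Data.Product using (Σ; ∃; _×_; _,_; proj₁; proj₂; uncurry)
open import Data.Product.Function.NonDependent.Propositional using (_×-↔_)
open import Data.Sum using (_⊎_; inj₁; inj₂)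
open import Data.Sum.Function.Propositional using (_⊎-↔_)
open import Data.Empty using (⊥; ⊥-elim)
open import Function using (_∘_; Inverse; Injection; _↔_; mk↔ₛ′)
open import Function.Properties.Inverse using (↔-refl; ↔-trans; Inverse⇒Injection)
open import Relation.Binary.PropositionalEquality

private variable
  l : ℕ
  A B : Set

-- Boolean vectors

infixl 6 _⊕_
_⊕_ : Vec Bool l → Vec Bool l → Vec Bool l
_⊕_ = zipWith _xor_

⊕-assoc : (u v w : Vec Bool l) → u ⊕ v ⊕ w ≡ u ⊕ (v ⊕ w)
⊕-assoc = zipWith-assoc xor-assoc

⊕-comm : (u v : Vec Bool l) → u ⊕ v ≡ v ⊕ u
⊕-comm = zipWith-comm xor-comm

⊕-self : (u : Vec Bool l) → u ⊕ u ≡ replicate l false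
⊕-self []      = refl
⊕-self (b ∷ u) = cong₂ _∷_ (xor-same b) (⊕-self u)

u⊕v⊕v≡u : (u v : Vec Bool l) → u ⊕ v ⊕ v ≡ u
u⊕v⊕v≡u u v = begin
  u ⊕ v ⊕ v            ≡⟨ ⊕-assoc u v v ⟩
  u ⊕ (v ⊕ v)          ≡⟨ cong (u ⊕_) (⊕-self v) ⟩
  u ⊕ replicate _ false ≡⟨ zipWith-identityʳ xor-identityʳ u ⟩
  u                    ∎
  where open ≡-Reasoning

u⊕v≡w⇒u≡w⊕v : (u v w : Vec Bool l) → u ⊕ v ≡ w → u ≡ w ⊕ v
u⊕v≡w⇒u≡w⊕v u v w refl = sym (u⊕v⊕v≡u u v)

⊕-cancelʳ : (u v w : Vec Bool l) → v ⊕ u ≡ w ⊕ u → v ≡ w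
⊕-cancelʳ u v w eq = trans (u⊕v≡w⇒u≡w⊕v v u (w ⊕ u) eq) (u⊕v⊕v≡u w u)

x⊕[y⊕z]≡y⊕[x⊕z] : (x y z : Vec Bool l) → x ⊕ (y ⊕ z) ≡ y ⊕ (x ⊕ z)
x⊕[y⊕z]≡y⊕[x⊕z] x y z = begin
  x ⊕ (y ⊕ z) ≡⟨ ⊕-assoc x y z ⟨
  x ⊕ y ⊕ z   ≡⟨ cong (_⊕ z) (⊕-comm x y) ⟩
  y ⊕ x ⊕ z   ≡⟨ ⊕-assoc y x z ⟩
  y ⊕ (x ⊕ z) ∎
  where open ≡-Reasoning

flipAt : Fin l → Vec Bool l → Vec Bool l
flipAt zero    (b ∷ u) = not b ∷ u
flipAt (suc d) (b ∷ u) = b ∷ flipAt d u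

flipAt-involutive : (d : Fin l) (u : Vec Bool l) → flipAt d (flipAt d u) ≡ u
flipAt-involutive zero    (b ∷ u) = cong (_∷ u) (not-involutive b)
flipAt-involutive (suc d) (b ∷ u) = cong (b ∷_) (flipAt-involutive d u)

flipAt-⊕ˡ : (d : Fin l) (u w : Vec Bool l) → flipAt d u ⊕ w ≡ flipAt d (u ⊕ w)
flipAt-⊕ˡ zero    (a ∷ u) (b ∷ w) = cong (_∷ u ⊕ w) (sym (not-distribˡ-xor a b))
flipAt-⊕ˡ (suc d) (a ∷ u) (b ∷ w) = cong ((a xor b) ∷_) (flipAt-⊕ˡ d u w)

flipAt-⊕ʳ : (d : Fin l) (u w : Vec Bool l) → u ⊕ flipAt d w ≡ flipAt d (u ⊕ w)
flipAt-⊕ʳ zero    (a ∷ u) (b ∷ w) = cong (_∷ u ⊕ w) (sym (not-distribʳ-xor a b))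
flipAt-⊕ʳ (suc d) (a ∷ u) (b ∷ w) = cong ((a xor b) ∷_) (flipAt-⊕ʳ d u w)

parity : Vec Bool l → Bool
parity []      = false
parity (b ∷ u) = b xor parity u

parity-flipAt : (d : Fin l) (u : Vec Bool l) → parity (flipAt d u) ≡ not (parity u)
parity-flipAt zero    (b ∷ u) = sym (not-distribˡ-xor b (parity u))
parity-flipAt (suc d) (b ∷ u) = trans (cong (b xor_) (parity-flipAt d u)) (sym (not-distribʳ-xor b (parity u)))

hamming-refl : (u : Vec Bool l) → hamming u u ≡ 0
hamming-refl []          = refl
hamming-refl (true ∷ u)  = hamming-refl u
hamming-refl (false ∷ u) = hamming-refl u

hamming-sym : (u v : Vec Bool l) → hamming u v ≡ hamming v u
hamming-sym []          []          = refl
hamming-sym (true ∷ u)  (true ∷ v)  = hamming-sym u v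
hamming-sym (false ∷ u) (false ∷ v) = hamming-sym u v
hamming-sym (true ∷ u)  (false ∷ v) = cong suc (hamming-sym u v)
hamming-sym (false ∷ u) (true ∷ v)  = cong suc (hamming-sym u v)

hamming≡0⇒≡ : (u v : Vec Bool l) → hamming u v ≡ 0 → u ≡ v
hamming≡0⇒≡ []          []          _  = refl
hamming≡0⇒≡ (true ∷ u)  (true ∷ v)  eq = cong (true ∷_) (hamming≡0⇒≡ u v eq)
hamming≡0⇒≡ (false ∷ u) (false ∷ v) eq = cong (false ∷_) (hamming≡0⇒≡ u v eq)

hamming-flipAt : (d : Fin l) (u : Vec Bool l) → hamming u (flipAt d u) ≡ 1
hamming-flipAt zero    (true ∷ u)  = cong suc (hamming-refl u)
hamming-flipAt zero    (false ∷ u) = cong suc (hamming-refl u)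
hamming-flipAt (suc d) (true ∷ u)  = hamming-flipAt d u
hamming-flipAt (suc d) (false ∷ u) = hamming-flipAt d u

flipAt-≢ : (d : Fin l) (u : Vec Bool l) → flipAt d u ≢ u
flipAt-≢ d u eq with trans (sym (hamming-flipAt d u)) (trans (cong (hamming u) eq) (hamming-refl u))
... | ()

hamming≡1⇒flipAt : (u v : Vec Bool l) → hamming u v ≡ 1 → ∃ λ d → v ≡ flipAt d u
hamming≡1⇒flipAt []          []          ()
hamming≡1⇒flipAt (true ∷ u)  (true ∷ v)  eq = let d , p = hamming≡1⇒flipAt u v eq in suc d , cong (true ∷_) p
hamming≡1⇒flipAt (false ∷ u) (false ∷ v) eq = let d , p = hamming≡1⇒flipAt u v eq in suc d , cong (false ∷_) p
hamming≡1⇒flipAt (true ∷ u)  (false ∷ v) eq = zero , cong (false ∷_) (sym (hamming≡0⇒≡ u v (cong pred eq)))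
hamming≡1⇒flipAt (false ∷ u) (true ∷ v)  eq = zero , cong (true ∷_) (sym (hamming≡0⇒≡ u v (cong pred eq)))

flipAt-injectiveˡ : (d d′ : Fin l) (u : Vec Bool l) → flipAt d u ≡ flipAt d′ u → d ≡ d′
flipAt-injectiveˡ zero    zero     _       _  = refl
flipAt-injectiveˡ (suc d) (suc d′) (b ∷ u) eq = cong suc (flipAt-injectiveˡ d d′ u (∷-injectiveʳ eq))
flipAt-injectiveˡ zero    (suc d′) (true ∷ u)  ()
flipAt-injectiveˡ zero    (suc d′) (false ∷ u) ()
flipAt-injectiveˡ (suc d) zero     (true ∷ u)  ()
flipAt-injectiveˡ (suc d) zero     (false ∷ u) ()

hamming-++ : ∀ {l r} (a a′ : Vec Bool l) (b b′ : Vec Bool r) →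
             hamming (a ++ b) (a′ ++ b′) ≡ hamming a a′ + hamming b b′
hamming-++ []          []           b b′ = refl
hamming-++ (true ∷ a)  (true ∷ a′)  b b′ = hamming-++ a a′ b b′
hamming-++ (false ∷ a) (false ∷ a′) b b′ = hamming-++ a a′ b b′
hamming-++ (true ∷ a)  (false ∷ a′) b b′ = cong suc (hamming-++ a a′ b b′)
hamming-++ (false ∷ a) (true ∷ a′)  b b′ = cong suc (hamming-++ a a′ b b′)

SameEdge : A → A → A → A → Set
SameEdge p q u v = (p ≡ u × q ≡ v) ⊎ (p ≡ v × q ≡ u)

SameEdge-sym : ∀ {p q u v : A} → SameEdge p q u v → SameEdge u v p q
SameEdge-sym (inj₁ (refl , refl)) = inj₁ (refl , refl)
SameEdge-sym (inj₂ (refl , refl)) = inj₂ (refl , refl)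

SameEdge-trans : ∀ {p q a b u v : A} → SameEdge p q a b → SameEdge a b u v → SameEdge p q u v
SameEdge-trans (inj₁ (refl , refl)) e = e
SameEdge-trans (inj₂ (refl , refl)) (inj₁ (refl , refl)) = inj₂ (refl , refl)
SameEdge-trans (inj₂ (refl , refl)) (inj₂ (refl , refl)) = inj₁ (refl , refl)

SameEdge-map : (f : A → B) → ∀ {p q u v} → SameEdge p q u v → SameEdge (f p) (f q) (f u) (f v)
SameEdge-map f (inj₁ (refl , refl)) = inj₁ (refl , refl)
SameEdge-map f (inj₂ (refl , refl)) = inj₂ (refl , refl)

SameEdge-injective : (f : A → B) → (∀ {a b} → f a ≡ f b → a ≡ b) →
                     ∀ {p q u v} → SameEdge (f p) (f q) (f u) (f v) → SameEdge p q u v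
SameEdge-injective f f-inj (inj₁ (e₁ , e₂)) = inj₁ (f-inj e₁ , f-inj e₂)
SameEdge-injective f f-inj (inj₂ (e₁ , e₂)) = inj₂ (f-inj e₁ , f-inj e₂)

-- Finite index sets

Finite : Set → Set
Finite A = Σ ℕ λ N → Fin N ↔ A

finite-↔ : Finite A → A ↔ B → Finite B
finite-↔ (N , e) f = N , ↔-trans e f

finite-⊎ : Finite A → Finite B → Finite (A ⊎ B)
finite-⊎ (M , e) (N , f) = M + N , ↔-trans +↔⊎ (e ⊎-↔ f)

finite-× : Finite A → Finite B → Finite (A × B)
finite-× (M , e) (N , f) = M * N , ↔-trans *↔× (e ×-↔ f)

finite-Vec : Finite A → ∀ l → Finite (Vec A l)
finite-Vec A-fin zero    = 1 , mk↔ₛ′ (λ _ → []) (λ _ → zero) (λ { [] → refl }) (λ { zero → refl })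
finite-Vec {A} A-fin (suc l) = finite-↔ (finite-× A-fin (finite-Vec A-fin l)) ×↔∷
  where
  uncons : Vec A (suc l) → A × Vec A l
  uncons (x ∷ xs) = x , xs
  ×↔∷ : (A × Vec A l) ↔ Vec A (suc l)
  ×↔∷ = mk↔ₛ′ (λ (x , xs) → x ∷ xs) uncons (λ { (x ∷ xs) → refl }) (λ _ → refl)

finite-Bool : Finite Bool
finite-Bool = 2 , 2↔Bool

HDecomposition-fromFinite :
  ∀ {H d} {I : Set} → Finite I → (copy : I → QCopy H d) →
  (∀ u v → QAdj u v → Σ (I × Fin (nE H)) λ (ι , e) → Covers (copy ι) e u v) →
  (∀ u v → QAdj u v → ∀ ι e ι′ e′ → Covers (copy ι) e u v → Covers (copy ι′) e′ u v → ι ≡ ι′ × e ≡ e′) →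
  HDecomposition H d
HDecomposition-fromFinite {H} (N , enum) copy covered unique =
  N , copy ∘ to , λ u v uv → reindexed-cover u v uv , reindexed-unique u v uv
  where
  open Inverse enum
  reindexed-cover : ∀ u v → QAdj u v → Σ (Fin N × Fin (nE H)) λ (j , e) → Covers (copy (to j)) e u v
  reindexed-cover u v uv with covered u v uv
  ... | (ι , e) , cov = (from ι , e) , subst (λ ι → Covers (copy ι) e u v) (sym (strictlyInverseˡ ι)) cov
  reindexed-unique : ∀ u v → QAdj u v → ∀ j e j′ e′ →
    Covers (copy (to j)) e u v → Covers (copy (to j′)) e′ u v → j ≡ j′ × e ≡ e′
  reindexed-unique u v uv j e j′ e′ cov cov′ with unique u v uv (to j) e (to j′) e′ cov cov′
  ... | to-j≡to-j′ , e≡e′ = Injection.injective (Inverse⇒Injection enum) to-j≡to-j′ , e≡e′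

cycPrev : ∀ {k} → Fin (suc k) → Fin (suc k)
cycPrev {k} zero    = fromℕ k
cycPrev     (suc i) = inject₁ i

module _ {k : ℕ} where

  cycNext-inject₁ : (i : Fin k) → cycNext (inject₁ i) ≡ suc i
  cycNext-inject₁ i = toℕ-injective (begin
    toℕ (cycNext (inject₁ i))     ≡⟨ toℕ-fromℕ< _ ⟩
    suc (toℕ (inject₁ i)) % suc k ≡⟨ cong (λ a → suc a % suc k) (toℕ-inject₁ i) ⟩
    suc (toℕ i) % suc k           ≡⟨ m<n⇒m%n≡m (s≤s (toℕ<n i)) ⟩
    suc (toℕ i)                   ∎)
    where open ≡-Reasoning

  cycNext-fromℕ : cycNext (fromℕ k) ≡ zero
  cycNext-fromℕ = toℕ-injective (begin
    toℕ (cycNext (fromℕ k))     ≡⟨ toℕ-fromℕ< _ ⟩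
    suc (toℕ (fromℕ k)) % suc k ≡⟨ cong (λ a → suc a % suc k) (toℕ-fromℕ k) ⟩
    suc k % suc k               ≡⟨ n%n≡0 (suc k) ⟩
    0                           ∎)
    where open ≡-Reasoning

  cycNext-cycPrev : (i : Fin (suc k)) → cycNext (cycPrev i) ≡ i
  cycNext-cycPrev zero    = cycNext-fromℕ
  cycNext-cycPrev (suc i) = cycNext-inject₁ i

  cycPrev-cycNext : (i : Fin (suc k)) → cycPrev (cycNext i) ≡ i
  cycPrev-cycNext i with view i
  ... | ‵fromℕ  rewrite cycNext-fromℕ = refl
  ... | ‵inj₁ {i = j} _ rewrite cycNext-inject₁ j = refl

-- Q_{3n} as the product of three copies of Q_n

one-summand≡1 : ∀ a b c → a + (b + (c + 0)) ≡ 1 →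
  (a ≡ 1 × b ≡ 0 × c ≡ 0) ⊎ (a ≡ 0 × b ≡ 1 × c ≡ 0) ⊎ (a ≡ 0 × b ≡ 0 × c ≡ 1)
one-summand≡1 1 0 0 _ = inj₁ (refl , refl , refl)
one-summand≡1 0 1 0 _ = inj₂ (inj₁ (refl , refl , refl))
one-summand≡1 0 0 1 _ = inj₂ (inj₂ (refl , refl , refl))
one-summand≡1 0 0 0 ()
one-summand≡1 0 0 (suc (suc _)) ()
one-summand≡1 0 1 (suc _) ()
one-summand≡1 0 (suc (suc _)) _ ()
one-summand≡1 1 0 (suc _) ()
one-summand≡1 1 (suc _) _ ()
one-summand≡1 (suc (suc _)) _ _ ()

module Triples (n : ℕ) where

  Triple : Set
  Triple = Vec Bool n × Vec Bool n × Vec Bool n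

  data Part : Set where
    X Y Z : Part

  move : Part → Fin n → Triple → Triple
  move X d (x , y , z) = flipAt d x , y , z
  move Y d (x , y , z) = x , flipAt d y , z
  move Z d (x , y , z) = x , y , flipAt d z

  flatten : Triple → Vec Bool (3 * n)
  flatten (x , y , z) = x ++ y ++ z ++ []

  project : Triple → Vec Bool n
  project (x , y , z) = x ⊕ (y ⊕ z)

  withX : Vec Bool n → Vec Bool n → Vec Bool n → Triple
  withX w y z = w ⊕ (y ⊕ z) , y , z

  withY : Vec Bool n → Vec Bool n → Vec Bool n → Triple
  withY w x z = x , w ⊕ (x ⊕ z) , z

  project-withX : ∀ w y z → project (withX w y z) ≡ w
  project-withX w y z = u⊕v⊕v≡u w (y ⊕ z)

  project-withY : ∀ w x z → project (withY w x z) ≡ w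
  project-withY w x z = trans (x⊕[y⊕z]≡y⊕[x⊕z] x (w ⊕ (x ⊕ z)) z) (u⊕v⊕v≡u w (x ⊕ z))

  project≡⇒withX : ∀ {w} x y z → project (x , y , z) ≡ w → (x , y , z) ≡ withX w y z
  project≡⇒withX x y z eq = cong (_, y , z) (u⊕v≡w⇒u≡w⊕v x (y ⊕ z) _ eq)

  project≡⇒withY : ∀ {w} x y z → project (x , y , z) ≡ w → (x , y , z) ≡ withY w x z
  project≡⇒withY x y z eq =
    cong (λ y′ → x , y′ , z) (u⊕v≡w⇒u≡w⊕v y (x ⊕ z) _ (trans (sym (x⊕[y⊕z]≡y⊕[x⊕z] x y z)) eq))

  project-move : ∀ s d t → project (move s d t) ≡ flipAt d (project t)
  project-move X d (x , y , z) = flipAt-⊕ˡ d x (y ⊕ z)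
  project-move Y d (x , y , z) = trans (cong (x ⊕_) (flipAt-⊕ˡ d y z)) (flipAt-⊕ʳ d x (y ⊕ z))
  project-move Z d (x , y , z) = trans (cong (x ⊕_) (flipAt-⊕ʳ d y z)) (flipAt-⊕ʳ d x (y ⊕ z))

  move-involutive : ∀ s d t → move s d (move s d t) ≡ t
  move-involutive X d (x , y , z) = cong (_, y , z) (flipAt-involutive d x)
  move-involutive Y d (x , y , z) = cong (λ y′ → x , y′ , z) (flipAt-involutive d y)
  move-involutive Z d (x , y , z) = cong (λ z′ → x , y , z′) (flipAt-involutive d z)

  move-injective : ∀ s s′ d d′ t → move s d t ≡ move s′ d′ t → s ≡ s′ × d ≡ d′
  move-injective X X d d′ (x , _ , _) eq = refl , flipAt-injectiveˡ d d′ x (cong proj₁ eq)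
  move-injective Y Y d d′ (_ , y , _) eq = refl , flipAt-injectiveˡ d d′ y (cong (proj₁ ∘ proj₂) eq)
  move-injective Z Z d d′ (_ , _ , z) eq = refl , flipAt-injectiveˡ d d′ z (cong (proj₂ ∘ proj₂) eq)
  move-injective X Y d _ (x , _ , _) eq = ⊥-elim (flipAt-≢ d x (cong proj₁ eq))
  move-injective X Z d _ (x , _ , _) eq = ⊥-elim (flipAt-≢ d x (cong proj₁ eq))
  move-injective Y X d _ (_ , y , _) eq = ⊥-elim (flipAt-≢ d y (cong (proj₁ ∘ proj₂) eq))
  move-injective Y Z d _ (_ , y , _) eq = ⊥-elim (flipAt-≢ d y (cong (proj₁ ∘ proj₂) eq))
  move-injective Z X d _ (_ , _ , z) eq = ⊥-elim (flipAt-≢ d z (cong (proj₂ ∘ proj₂) eq))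
  move-injective Z Y d _ (_ , _ , z) eq = ⊥-elim (flipAt-≢ d z (cong (proj₂ ∘ proj₂) eq))

  hamming-flatten : ∀ x y z x′ y′ z′ →
    hamming (flatten (x , y , z)) (flatten (x′ , y′ , z′)) ≡ hamming x x′ + (hamming y y′ + (hamming z z′ + 0))
  hamming-flatten x y z x′ y′ z′ = begin
    hamming (x ++ y ++ z ++ []) (x′ ++ y′ ++ z′ ++ [])
      ≡⟨ hamming-++ x x′ _ _ ⟩
    hamming x x′ + hamming (y ++ z ++ []) (y′ ++ z′ ++ [])
      ≡⟨ cong (hamming x x′ +_) (hamming-++ y y′ _ _) ⟩
    hamming x x′ + (hamming y y′ + hamming (z ++ []) (z′ ++ []))
      ≡⟨ cong (λ h → hamming x x′ + (hamming y y′ + h)) (hamming-++ z z′ [] []) ⟩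
    hamming x x′ + (hamming y y′ + (hamming z z′ + 0))
      ∎
    where open ≡-Reasoning

  hamming-flatten-move : ∀ s d t → hamming (flatten t) (flatten (move s d t)) ≡ 1
  hamming-flatten-move X d (x , y , z)
    rewrite hamming-flatten x y z (flipAt d x) y z | hamming-flipAt d x | hamming-refl y | hamming-refl z = refl
  hamming-flatten-move Y d (x , y , z)
    rewrite hamming-flatten x y z x (flipAt d y) z | hamming-refl x | hamming-flipAt d y | hamming-refl z = refl
  hamming-flatten-move Z d (x , y , z)
    rewrite hamming-flatten x y z x y (flipAt d z) | hamming-refl x | hamming-refl y | hamming-flipAt d z = refl

  flatten-injective : ∀ {t t′} → flatten t ≡ flatten t′ → t ≡ t′
  flatten-injective {x , y , z} {x′ , y′ , z′} eq with ++-injective x x′ eq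
  ... | refl , eq₁ with ++-injective y y′ eq₁
  ... | refl , eq₂ with ++-injective z z′ eq₂
  ... | refl , _ = refl

  flatten-surjective : (w : Vec Bool (3 * n)) → ∃ λ t → w ≡ flatten t
  flatten-surjective w with Vec.splitAt n w
  ... | x , w₁ , refl with Vec.splitAt n w₁
  ... | y , w₂ , refl with Vec.splitAt n w₂
  ... | z , [] , refl = (x , y , z) , refl

  adjacent⇒move : ∀ t t′ → hamming (flatten t) (flatten t′) ≡ 1 → ∃ λ s → ∃ λ d → t′ ≡ move s d t
  adjacent⇒move (x , y , z) (x′ , y′ , z′) adj
    with one-summand≡1 (hamming x x′) (hamming y y′) (hamming z z′) (trans (sym (hamming-flatten x y z x′ y′ z′)) adj)
  ... | inj₁ (hx , hy , hz) with d , refl ← hamming≡1⇒flipAt x x′ hx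
    rewrite hamming≡0⇒≡ y y′ hy | hamming≡0⇒≡ z z′ hz = X , d , refl
  ... | inj₂ (inj₁ (hx , hy , hz)) with d , refl ← hamming≡1⇒flipAt y y′ hy
    rewrite hamming≡0⇒≡ x x′ hx | hamming≡0⇒≡ z z′ hz = Y , d , refl
  ... | inj₂ (inj₂ (hx , hy , hz)) with d , refl ← hamming≡1⇒flipAt z z′ hz
    rewrite hamming≡0⇒≡ x x′ hx | hamming≡0⇒≡ y y′ hy = Z , d , refl

module SunletConstruction
  (m k′ N : ℕ) (cycle : Fin N → QCopy (Cycle (suc k′)) (suc m))
  (partition : ∀ u v → QAdj u v →
     Σ (Fin N × Fin (suc k′)) (λ p → Covers (cycle (proj₁ p)) (proj₂ p) u v)
     × (∀ j e j′ e′ → Covers (cycle j) e u v → Covers (cycle j′) e′ u v → j ≡ j′ × e ≡ e′))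
  where

  n k : ℕ
  n = suc m
  k = suc k′

  open Triples n

  vertex : Fin N → Fin k → Vec Bool n
  vertex j = φ (cycle j)

  dir : Fin N → Fin k → Fin n
  dir j i = proj₁ (hamming≡1⇒flipAt (vertex j i) (vertex j (cycNext i)) (hom (cycle j) i))

  dirIn : Fin N → Fin k → Fin n
  dirIn j i = dir j (cycPrev i)

  vertex-cycNext : ∀ j i → vertex j (cycNext i) ≡ flipAt (dir j i) (vertex j i)
  vertex-cycNext j i = proj₂ (hamming≡1⇒flipAt (vertex j i) (vertex j (cycNext i)) (hom (cycle j) i))

  vertex-cycPrev : ∀ j i → vertex j (cycPrev i) ≡ flipAt (dirIn j i) (vertex j i)
  vertex-cycPrev j i = begin
    vertex j (cycPrev i)                                ≡⟨ flipAt-involutive a _ ⟨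
    flipAt a (flipAt a (vertex j (cycPrev i)))          ≡⟨ cong (flipAt a) (vertex-cycNext j (cycPrev i)) ⟨
    flipAt a (vertex j (cycNext (cycPrev i)))           ≡⟨ cong (flipAt a ∘ vertex j) (cycNext-cycPrev i) ⟩
    flipAt a (vertex j i)                               ∎
    where
    open ≡-Reasoning
    a : Fin n
    a = dirIn j i

  dir-unique : ∀ {j i u d} → vertex j i ≡ u → vertex j (cycNext i) ≡ flipAt d u → dir j i ≡ d
  dir-unique {j} {i} {u} {d} refl eq = flipAt-injectiveˡ _ _ u (trans (sym (vertex-cycNext j i)) eq)

  cycleEdge-unique : ∀ {j i j′ i′} → Covers (cycle j′) i′ (vertex j i) (vertex j (cycNext i)) → j′ ≡ j × i′ ≡ i
  cycleEdge-unique {j} {i} cov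
    with refl , refl ← proj₂ (partition _ _ (hom (cycle j) i)) j i _ _ (inj₁ (refl , refl)) cov = refl , refl

  cycleEdge-notReversed : ∀ {j i j′ i′} → vertex j′ i′ ≡ vertex j (cycNext i) → vertex j′ (cycNext i′) ≡ vertex j i → ⊥
  cycleEdge-notReversed {j} {i} e₁ e₂ with refl , refl ← cycleEdge-unique (inj₂ (e₁ , e₂))
    with () ← trans (sym (hom (cycle j) i)) (trans (cong (hamming (vertex j i)) (sym e₁)) (hamming-refl (vertex j i)))

  data Copy : Set where
    xCopy : Fin N → Vec Bool n → Vec Bool n → Copy
    -- the even third block z of a y-copy is stored as its tail
    yCopy : Fin N → Vec Bool n → Vec Bool m → Copy

  evenExtend : Vec Bool m → Vec Bool n
  evenExtend z = parity z ∷ z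

  parity-evenExtend : ∀ z → parity (evenExtend z) ≡ false
  parity-evenExtend z = xor-same (parity z)

  evenExtend-tail : ∀ z → parity z ≡ false → evenExtend (tail z) ≡ z
  evenExtend-tail (false ∷ z) even = cong (_∷ z) even
  evenExtend-tail (true ∷ z)  even = cong (_∷ z) (trans (sym (not-involutive _)) (cong not even))

  cycleOf : Copy → Fin N
  cycleOf (xCopy j _ _) = j
  cycleOf (yCopy j _ _) = j

  rimPart : Copy → Part
  rimPart (xCopy _ _ _) = X
  rimPart (yCopy _ _ _) = Y

  rim : Copy → Fin k → Triple
  rim (xCopy j y z) i = withX (vertex j i) y z
  rim (yCopy j x z) i = withY (vertex j i) x (evenExtend z)

  project-rim : ∀ ι i → project (rim ι i) ≡ vertex (cycleOf ι) i
  project-rim (xCopy j y z) i = project-withX (vertex j i) y z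
  project-rim (yCopy j x z) i = project-withY (vertex j i) x (evenExtend z)

  rim-cycNext : ∀ ι i → rim ι (cycNext i) ≡ move (rimPart ι) (dir (cycleOf ι) i) (rim ι i)
  rim-cycNext (xCopy j y z) i =
    cong (_, y , z) (trans (cong (_⊕ (y ⊕ z)) (vertex-cycNext j i)) (flipAt-⊕ˡ (dir j i) (vertex j i) (y ⊕ z)))
  rim-cycNext (yCopy j x z) i = cong (λ y → x , y , evenExtend z)
    (trans (cong (_⊕ (x ⊕ evenExtend z)) (vertex-cycNext j i)) (flipAt-⊕ˡ (dir j i) (vertex j i) (x ⊕ evenExtend z)))

  data Side : Set where
    outgoing incoming : Side

  along : Fin N → Fin k → Side → Fin n
  along j i outgoing = dir j i
  along j i incoming = dirIn j i

  step : Fin N → Fin k → Part × Side → Triple → Triple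
  step j i (s , σ) = move s (along j i σ)

  xSpoke : Bool → Bool → Part × Side
  xSpoke false _     = Z , outgoing
  xSpoke true  false = Y , outgoing
  xSpoke true  true  = Y , incoming

  spoke : Copy → Fin k → Part × Side
  spoke (xCopy j y z) i = xSpoke (parity z) (parity (vertex j i ⊕ (y ⊕ z)))
  spoke (yCopy _ _ _) _ = Z , incoming

  tip : Copy → Fin k → Triple
  tip ι i = step (cycleOf ι) i (spoke ι i) (rim ι i)

  record Lift : Set where
    constructor lift
    field
      base : Triple
      part : Part
      cyc  : Fin N
      pos  : Fin k
  open Lift

  top : Lift → Triple
  top (lift t s j i) = move s (dir j i) t

  Valid : Lift → Set
  Valid (lift t _ j i) = project t ≡ vertex j i

  project-top : ∀ L → Valid L → project (top L) ≡ vertex (cyc L) (cycNext (pos L))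
  project-top (lift t s j i) valid =
    trans (project-move s (dir j i) t) (trans (cong (flipAt (dir j i)) valid) (sym (vertex-cycNext j i)))

  spokeLift : Fin N → Fin k → Triple → Part × Side → Lift
  spokeLift j i t (s , outgoing) = lift t s j i
  spokeLift j i t (s , incoming) = lift (move s (dirIn j i) t) s j (cycPrev i)

  spokeLift-valid : ∀ j i t σ → project t ≡ vertex j i → Valid (spokeLift j i t σ)
  spokeLift-valid j i t (s , outgoing) valid = valid
  spokeLift-valid j i t (s , incoming) valid =
    trans (project-move s (dirIn j i) t) (trans (cong (flipAt (dirIn j i)) valid) (sym (vertex-cycPrev j i)))

  spokeLift-ends : ∀ j i t σ → SameEdge t (step j i σ t) (base (spokeLift j i t σ)) (top (spokeLift j i t σ))
  spokeLift-ends j i t (s , outgoing) = inj₁ (refl , refl)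
  spokeLift-ends j i t (s , incoming) = inj₂ (sym (move-involutive s (dirIn j i) t) , refl)

  spokeLift-incoming-top : ∀ L → spokeLift (cyc L) (cycNext (pos L)) (top L) (part L , incoming) ≡ L
  spokeLift-incoming-top (lift t s j i)
    rewrite cycPrev-cycNext i | move-involutive s (dir j i) t = refl

  label : Copy → Fin k ⊎ Fin k → Lift
  label ι (inj₁ i) = lift (rim ι i) (rimPart ι) (cycleOf ι) i
  label ι (inj₂ i) = spokeLift (cycleOf ι) i (rim ι i) (spoke ι i)

  label-valid : ∀ ι E → Valid (label ι E)
  label-valid ι (inj₁ i) = project-rim ι i
  label-valid ι (inj₂ i) = spokeLift-valid (cycleOf ι) i (rim ι i) (spoke ι i) (project-rim ι i)

  ends : Copy → Fin k ⊎ Fin k → Triple × Triple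
  ends ι (inj₁ i) = rim ι i , rim ι (cycNext i)
  ends ι (inj₂ i) = rim ι i , tip ι i

  ends-label : ∀ ι E → SameEdge (proj₁ (ends ι E)) (proj₂ (ends ι E)) (base (label ι E)) (top (label ι E))
  ends-label ι (inj₁ i) = inj₁ (refl , rim-cycNext ι i)
  ends-label ι (inj₂ i) = spokeLift-ends (cycleOf ι) i (rim ι i) (spoke ι i)

  ownerY : Bool → Bool → Fin N → Fin k → Triple → Copy × (Fin k ⊎ Fin k)
  ownerY false _     j i (x , y , z) = yCopy j x (tail z) , inj₁ i
  ownerY true  false j i (x , y , z) = xCopy j y z , inj₂ i
  ownerY true  true  j i (x , y , z) = xCopy j (flipAt (dir j i) y) z , inj₂ (cycNext i)

  ownerZ : Bool → Fin N → Fin k → Triple → Copy × (Fin k ⊎ Fin k)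
  ownerZ false j i (x , y , z) = xCopy j y z , inj₂ i
  ownerZ true  j i (x , y , z) = yCopy j x (tail (flipAt (dir j i) z)) , inj₂ (cycNext i)

  owner : Lift → Copy × (Fin k ⊎ Fin k)
  owner (lift (x , y , z) X j i) = xCopy j y z , inj₁ i
  owner (lift (x , y , z) Y j i) = ownerY (parity z) (parity x) j i (x , y , z)
  owner (lift (x , y , z) Z j i) = ownerZ (parity z) j i (x , y , z)

  owner-xSpoke : ∀ j y z i b₁ b₂ → parity z ≡ b₁ → parity (vertex j i ⊕ (y ⊕ z)) ≡ b₂ →
                 owner (spokeLift j i (withX (vertex j i) y z) (xSpoke b₁ b₂)) ≡ (xCopy j y z , inj₂ i)
  owner-xSpoke j y z i false _     pz px rewrite pz = refl
  owner-xSpoke j y z i true  false pz px rewrite pz | px = refl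
  owner-xSpoke j y z i true  true  pz px
    rewrite pz | px | flipAt-involutive (dirIn j i) y | cycNext-cycPrev i = refl

  owner-label : ∀ ι E → owner (label ι E) ≡ (ι , E)
  owner-label (xCopy j y z) (inj₁ i) = refl
  owner-label (yCopy j x z) (inj₁ i) rewrite parity-evenExtend z = refl
  owner-label (xCopy j y z) (inj₂ i) = owner-xSpoke j y z i _ _ refl refl
  owner-label (yCopy j x z) (inj₂ i)
    rewrite parity-flipAt (dirIn j i) (evenExtend z) | parity-evenExtend z
          | flipAt-involutive (dirIn j i) (evenExtend z) | cycNext-cycPrev i = refl

  label-xCopy-spoke : ∀ x y z j i → project (x , y , z) ≡ vertex j i →
                      label (xCopy j y z) (inj₂ i) ≡ spokeLift j i (x , y , z) (xSpoke (parity z) (parity x))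
  label-xCopy-spoke x y z j i valid =
    cong (λ t → spokeLift j i t (xSpoke (parity z) (parity (proj₁ t)))) (sym (project≡⇒withX x y z valid))

  label-ownerY : ∀ x y z j i b₁ b₂ → parity z ≡ b₁ → parity x ≡ b₂ → Valid (lift (x , y , z) Y j i) →
                 uncurry label (ownerY b₁ b₂ j i (x , y , z)) ≡ lift (x , y , z) Y j i
  label-ownerY x y z j i false _ pz _ valid = cong (λ t → lift t Y j i)
    (trans (cong (withY (vertex j i) x) (evenExtend-tail z pz)) (sym (project≡⇒withY x y z valid)))
  label-ownerY x y z j i true false pz px valid =
    trans (label-xCopy-spoke x y z j i valid) (cong (spokeLift j i (x , y , z)) (cong₂ xSpoke pz px))
  label-ownerY x y z j i true true pz px valid = begin
    label (xCopy j (flipAt (dir j i) y) z) (inj₂ (cycNext i))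
      ≡⟨ label-xCopy-spoke x _ z j (cycNext i) (project-top L valid) ⟩
    spokeLift j (cycNext i) (top L) (xSpoke (parity z) (parity x))
      ≡⟨ cong (spokeLift j (cycNext i) (top L)) (cong₂ xSpoke pz px) ⟩
    spokeLift j (cycNext i) (top L) (Y , incoming)
      ≡⟨ spokeLift-incoming-top L ⟩
    L ∎
    where
    open ≡-Reasoning
    L : Lift
    L = lift (x , y , z) Y j i

  label-ownerZ : ∀ x y z j i b → parity z ≡ b → Valid (lift (x , y , z) Z j i) →
                 uncurry label (ownerZ b j i (x , y , z)) ≡ lift (x , y , z) Z j i
  label-ownerZ x y z j i false pz valid =
    trans (label-xCopy-spoke x y z j i valid) (cong (λ b → spokeLift j i (x , y , z) (xSpoke b (parity x))) pz)
  label-ownerZ x y z j i true pz valid = begin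
    spokeLift j (cycNext i) (withY (vertex j (cycNext i)) x (evenExtend (tail z′))) (Z , incoming)
      ≡⟨ cong (λ t → spokeLift j (cycNext i) t (Z , incoming)) rim≡top ⟩
    spokeLift j (cycNext i) (top L) (Z , incoming)
      ≡⟨ spokeLift-incoming-top L ⟩
    L ∎
    where
    open ≡-Reasoning
    L : Lift
    L = lift (x , y , z) Z j i
    z′ : Vec Bool n
    z′ = flipAt (dir j i) z
    rim≡top : withY (vertex j (cycNext i)) x (evenExtend (tail z′)) ≡ top L
    rim≡top = trans (cong (withY (vertex j (cycNext i)) x) (evenExtend-tail z′ (trans (parity-flipAt (dir j i) z) (cong not pz))))
                    (sym (project≡⇒withY x y z′ (project-top L valid)))

  label-owner : ∀ L → Valid L → uncurry label (owner L) ≡ L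
  label-owner (lift (x , y , z) X j i) valid = cong (λ t → lift t X j i) (sym (project≡⇒withX x y z valid))
  label-owner (lift (x , y , z) Y j i) valid = label-ownerY x y z j i _ _ refl refl valid
  label-owner (lift (x , y , z) Z j i) valid = label-ownerZ x y z j i _ refl valid

  vertex-cycNext-cong : ∀ {j i j′ i′} → dir j′ i′ ≡ dir j i → vertex j′ i′ ≡ vertex j i →
                        vertex j′ (cycNext i′) ≡ vertex j (cycNext i)
  vertex-cycNext-cong {j} {i} {j′} {i′} dir≡ vertex≡ = begin
    vertex j′ (cycNext i′)              ≡⟨ vertex-cycNext j′ i′ ⟩
    flipAt (dir j′ i′) (vertex j′ i′)   ≡⟨ cong₂ flipAt dir≡ vertex≡ ⟩
    flipAt (dir j i) (vertex j i)       ≡⟨ vertex-cycNext j i ⟨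
    vertex j (cycNext i)                ∎
    where open ≡-Reasoning

  lift-unique : ∀ L L′ → Valid L → Valid L′ → SameEdge (base L′) (top L′) (base L) (top L) → L′ ≡ L
  lift-unique (lift t s j i) (lift _ s′ j′ i′) valid valid′ (inj₁ (refl , top≡))
    with refl , dir≡ ← move-injective s′ s (dir j′ i′) (dir j i) t top≡
    with refl , refl ← cycleEdge-unique
           (inj₁ (trans (sym valid′) valid , vertex-cycNext-cong dir≡ (trans (sym valid′) valid)))
    = refl
  lift-unique L@(lift t s j i) L′@(lift t′ s′ j′ i′) valid valid′ (inj₂ (base′≡top , top′≡base)) =
    ⊥-elim (cycleEdge-notReversed
      (trans (sym valid′) (trans (cong project base′≡top) (project-top L valid)))
      (trans (sym (project-top L′ valid′)) (trans (cong project top′≡base) valid)))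

  lift-exists : ∀ t s d → Σ Lift λ L → Valid L × SameEdge (base L) (top L) t (move s d t)
  lift-exists t s d with proj₁ (partition w (flipAt d w) (hamming-flipAt d w))
    where
    w : Vec Bool n
    w = project t
  ... | (j , i) , inj₁ (vertex≡ , vertex′≡) =
    lift t s j i , sym vertex≡ , inj₁ (refl , cong (λ a → move s a t) (dir-unique vertex≡ vertex′≡))
  ... | (j , i) , inj₂ (vertex≡ , vertex′≡) =
    lift (move s d t) s j i , trans (project-move s d t) (sym vertex≡) ,
    inj₂ (refl , trans (cong (λ a → move s a (move s d t)) dir≡) (move-involutive s d t))
    where
    dir≡ : dir j i ≡ d
    dir≡ = dir-unique vertex≡ (trans vertex′≡ (sym (flipAt-involutive d (project t))))

  vertexAt : Copy → Fin k ⊎ Fin k → Triple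
  vertexAt ι (inj₁ i) = rim ι i
  vertexAt ι (inj₂ i) = tip ι i

  rim-injective : ∀ ι {i i′} → rim ι i ≡ rim ι i′ → i ≡ i′
  rim-injective ι {i} {i′} eq =
    inj (cycle (cycleOf ι)) (trans (sym (project-rim ι i)) (trans (cong project eq) (project-rim ι i′)))

  xSpoke-keeps-X : ∀ j i b₁ b₂ t → proj₁ (step j i (xSpoke b₁ b₂) t) ≡ proj₁ t
  xSpoke-keeps-X j i false _     (x , y , z) = refl
  xSpoke-keeps-X j i true  false (x , y , z) = refl
  xSpoke-keeps-X j i true  true  (x , y , z) = refl

  xSpoke-leaves-YZ : ∀ j i b₁ b₂ x x′ y z → step j i (xSpoke b₁ b₂) (x′ , y , z) ≢ (x , y , z)
  xSpoke-leaves-YZ j i false _     x x′ y z eq = flipAt-≢ (dir j i) z (cong (proj₂ ∘ proj₂) eq)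
  xSpoke-leaves-YZ j i true  false x x′ y z eq = flipAt-≢ (dir j i) y (cong (proj₁ ∘ proj₂) eq)
  xSpoke-leaves-YZ j i true  true  x x′ y z eq = flipAt-≢ (dirIn j i) y (cong (proj₁ ∘ proj₂) eq)

  xCopy-tip-X : ∀ j y z i → proj₁ (tip (xCopy j y z) i) ≡ vertex j i ⊕ (y ⊕ z)
  xCopy-tip-X j y z i = xSpoke-keeps-X j i (parity z) (parity (vertex j i ⊕ (y ⊕ z))) (rim (xCopy j y z) i)

  tip-injective : ∀ ι {i i′} → tip ι i ≡ tip ι i′ → i ≡ i′
  tip-injective (xCopy j y z) {i} {i′} eq = inj (cycle j)
    (⊕-cancelʳ (y ⊕ z) _ _ (trans (sym (xCopy-tip-X j y z i)) (trans (cong proj₁ eq) (xCopy-tip-X j y z i′))))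
  tip-injective (yCopy j x z) eq = inj (cycle j) (⊕-cancelʳ (x ⊕ evenExtend z) _ _ (cong (proj₁ ∘ proj₂) eq))

  rim≢tip : ∀ ι i i′ → rim ι i ≢ tip ι i′
  rim≢tip (xCopy j y z) i i′ eq =
    xSpoke-leaves-YZ j i′ (parity z) (parity (vertex j i′ ⊕ (y ⊕ z))) _ (vertex j i′ ⊕ (y ⊕ z)) y z (sym eq)
  rim≢tip (yCopy j x z) i i′ eq = flipAt-≢ (dirIn j i′) (evenExtend z) (sym (cong (proj₂ ∘ proj₂) eq))

  vertexAt-injective : ∀ ι {V V′} → vertexAt ι V ≡ vertexAt ι V′ → V ≡ V′
  vertexAt-injective ι {inj₁ i} {inj₁ i′} eq = cong inj₁ (rim-injective ι eq)
  vertexAt-injective ι {inj₂ i} {inj₂ i′} eq = cong inj₂ (tip-injective ι eq)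
  vertexAt-injective ι {inj₁ i} {inj₂ i′} eq = ⊥-elim (rim≢tip ι i i′ eq)
  vertexAt-injective ι {inj₂ i} {inj₁ i′} eq = ⊥-elim (rim≢tip ι i′ i (sym eq))

  sunletVertex : Copy → Fin (k + k) → Vec Bool (3 * n)
  sunletVertex ι = flatten ∘ vertexAt ι ∘ splitAt k

  edgeEnds : Copy → Fin (k + k) → Vec Bool (3 * n) × Vec Bool (3 * n)
  edgeEnds ι e = sunletVertex ι (proj₁ (sunletEdge k e)) , sunletVertex ι (proj₂ (sunletEdge k e))

  edgeEnds-join : ∀ ι E → edgeEnds ι (join k k E) ≡ (flatten (proj₁ (ends ι E)) , flatten (proj₂ (ends ι E)))
  edgeEnds-join ι (inj₁ i) rewrite splitAt-↑ˡ k i k | splitAt-↑ˡ k i k | splitAt-↑ˡ k (cycNext i) k = refl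
  edgeEnds-join ι (inj₂ i) rewrite splitAt-↑ʳ k k i | splitAt-↑ˡ k i k | splitAt-↑ʳ k k i = refl

  edgeEnds-label : ∀ ι e → SameEdge (proj₁ (edgeEnds ι e)) (proj₂ (edgeEnds ι e))
                                    (flatten (base (label ι (splitAt k e)))) (flatten (top (label ι (splitAt k e))))
  edgeEnds-label ι e =
    subst (λ e′ → SameEdge (proj₁ (edgeEnds ι e′)) (proj₂ (edgeEnds ι e′)) (flatten (base L)) (flatten (top L)))
      (join-splitAt k k e)
      (subst (λ p → SameEdge (proj₁ p) (proj₂ p) (flatten (base L)) (flatten (top L)))
        (sym (edgeEnds-join ι (splitAt k e)))
        (SameEdge-map flatten (ends-label ι (splitAt k e))))
    where
    L : Lift
    L = label ι (splitAt k e)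

  SameEdge-adjacent : ∀ {a b} L → SameEdge a b (flatten (base L)) (flatten (top L)) → hamming a b ≡ 1
  SameEdge-adjacent (lift t s j i) (inj₁ (refl , refl)) = hamming-flatten-move s (dir j i) t
  SameEdge-adjacent (lift t s j i) (inj₂ (refl , refl)) =
    trans (hamming-sym (flatten (move s (dir j i) t)) (flatten t)) (hamming-flatten-move s (dir j i) t)

  sunlet : Copy → QCopy (Sunlet k) (3 * n)
  sunlet ι = record
    { φ   = sunletVertex ι
    ; inj = Injection.injective (Inverse⇒Injection +↔⊎) ∘ vertexAt-injective ι ∘ flatten-injective
    ; hom = λ e → SameEdge-adjacent (label ι (splitAt k e)) (edgeEnds-label ι e)
    }

  covers⇒label : ∀ ι e {u v} → Covers (sunlet ι) e u v →
                 SameEdge (flatten (base (label ι (splitAt k e)))) (flatten (top (label ι (splitAt k e)))) u v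
  covers⇒label ι e = SameEdge-trans (SameEdge-sym (edgeEnds-label ι e))

  label⇒covers : ∀ ι e {u v} →
                 SameEdge (flatten (base (label ι (splitAt k e)))) (flatten (top (label ι (splitAt k e)))) u v →
                 Covers (sunlet ι) e u v
  label⇒covers ι e = SameEdge-trans (edgeEnds-label ι e)

  sunlet-covered : ∀ u v → QAdj u v → Σ (Copy × Fin (k + k)) λ p → Covers (sunlet (proj₁ p)) (proj₂ p) u v
  sunlet-covered u v adj
    with t , refl ← flatten-surjective u | t′ , refl ← flatten-surjective v
    with s , d , refl ← adjacent⇒move t t′ adj
    with L , valid , same ← lift-exists t s d
    = (ι , join k k E) , label⇒covers ι (join k k E)
        (subst (λ L′ → SameEdge (flatten (base L′)) (flatten (top L′)) (flatten t) (flatten (move s d t)))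
               (sym labelled) (SameEdge-map flatten same))
    where
    ι : Copy
    ι = proj₁ (owner L)
    E : Fin k ⊎ Fin k
    E = proj₂ (owner L)
    labelled : label ι (splitAt k (join k k E)) ≡ L
    labelled = trans (cong (label ι) (splitAt-join k k E)) (label-owner L valid)

  sunlet-unique : ∀ u v → QAdj u v → ∀ ι e ι′ e′ →
                  Covers (sunlet ι) e u v → Covers (sunlet ι′) e′ u v → ι ≡ ι′ × e ≡ e′
  sunlet-unique u v _ ι e ι′ e′ cov cov′ =
    cong proj₁ owners≡ , Injection.injective (Inverse⇒Injection +↔⊎) (cong proj₂ owners≡)
    where
    L L′ : Lift
    L  = label ι (splitAt k e)
    L′ = label ι′ (splitAt k e′)
    L≡L′ : L ≡ L′
    L≡L′ = lift-unique L′ L (label-valid ι′ (splitAt k e′)) (label-valid ι (splitAt k e))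
        (SameEdge-injective flatten flatten-injective
        (SameEdge-trans (covers⇒label ι e cov) (SameEdge-sym (covers⇒label ι′ e′ cov′))))
    owners≡ : (ι , splitAt k e) ≡ (ι′ , splitAt k e′)
    owners≡ = trans (sym (owner-label ι (splitAt k e))) (trans (cong owner L≡L′) (owner-label ι′ (splitAt k e′)))

  copies-finite : Finite Copy
  copies-finite = finite-↔
    (finite-⊎ (finite-× (N , ↔-refl) (finite-× cube cube))
              (finite-× (N , ↔-refl) (finite-× cube (finite-Vec finite-Bool m))))
    (mk↔ₛ′ toCopy fromCopy (λ { (xCopy _ _ _) → refl ; (yCopy _ _ _) → refl })
                           (λ { (inj₁ _) → refl ; (inj₂ _) → refl }))
    where
    cube : Finite (Vec Bool n)
    cube = finite-Vec finite-Bool n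
    toCopy : (Fin N × Vec Bool n × Vec Bool n) ⊎ (Fin N × Vec Bool n × Vec Bool m) → Copy
    toCopy (inj₁ (j , y , z)) = xCopy j y z
    toCopy (inj₂ (j , x , z)) = yCopy j x z
    fromCopy : Copy → (Fin N × Vec Bool n × Vec Bool n) ⊎ (Fin N × Vec Bool n × Vec Bool m)
    fromCopy (xCopy j y z) = inj₁ (j , y , z)
    fromCopy (yCopy j x z) = inj₂ (j , x , z)

  sunletDecomposition : HDecomposition (Sunlet k) (3 * n)
  sunletDecomposition = HDecomposition-fromFinite copies-finite sunlet sunlet-covered sunlet-unique

-- 3 ≤ k only serves to exclude k = 0: the construction never uses that the cycles are long.
lemma13 : (n k : ℕ) → 1 ≤ n → 3 ≤ k →
    HDecomposition (Cycle k) n → HDecomposition (Sunlet k) (3 * n)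
lemma13 (suc m) (suc k′) _ _ (N , cycle , partition) =
  SunletConstruction.sunletDecomposition m k′ N cycle partition
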